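{- Let $n\ge1$, let $S\subseteq\mathbb{Z}_{2^n}$, and let $a$ be an integer with $1\le a\le n$. Then $|C(a,a,a+)|\ge\max\{|S_a|(|S_{a+}|-|L_a|+|S_a|),\ |S_{a+}|(2|S_a|-|L_a|),\ 0\}$.
   Context: $\mathbb{Z}_{2^n}$ is the cyclic group of integers modulo $2^n$. For $1\le i\le n$, $L_i=\{x\in\mathbb{Z}_{2^n}: x\equiv 2^{i-1}\pmod{2^i}\}$ and $L_{n+1}=\{0\}$. Set $S_i=S\cap L_i$ and $S_{a+}=S\cap(L_{a+1}\cup L_{a+2}\cup\dots\cup L_{n+1})$. Define $C(a,a,a+)=\{(x,y,z)\in S^3: x+y=z,\ x\in S_a,\ y\in S_a,\ z\in S_{a+}\}$ (addition modulo $2^n$). -}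

module Defs where

open import Data.Bool using (Bool; true; false; _∧_; _∨_; if_then_else_)
import Data.Nat
open import Data.Nat using (ℕ; zero; suc; _+_; _∸_; _^_; _≡ᵇ_; _≤ᵇ_; _%_)
open import Data.Fin using (Fin; toℕ)
open import Data.List using (List; []; _∷_; allFin; upTo; map; concatMap)
open import Data.Bool.ListAction using (any)
open import Data.Nat.Properties using (m^n≢0)
open import Data.Product using (_×_; _,_)

-- The cyclic group Z_{2^n} is modelled as Fin (2 ^ n), an element x
-- being identified with the residue toℕ x ∈ {0, …, 2^n - 1}.
Zmod : ℕ → Set
Zmod n = Fin (2 ^ n)

modPow2 : ℕ → ℕ → ℕ
modPow2 x k = _%_ x (2 ^ k) {{m^n≢0 2 k}}

addMod : (n : ℕ) → Zmod n → Zmod n → ℕ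
addMod n x y = modPow2 (toℕ x + toℕ y) n

count : {A : Set} → (A → Bool) → List A → ℕ
count p []       = 0
count p (x ∷ xs) = if p x then suc (count p xs) else count p xs

-- membership in the level L_i of Z_{2^n}:
--   for 1 ≤ i ≤ n : x ≡ 2^(i-1) (mod 2^i)
--   for i = n+1   : x = 0
--   otherwise (i = 0 or i > n+1) : L_i is not defined; taken empty
inL : (n i : ℕ) → Zmod n → Bool
inL n zero    x = false
inL n (suc j) x =
  if suc j ≤ᵇ n then (modPow2 (toℕ x) (suc j)) ≡ᵇ (2 ^ j)
  else (if suc j ≡ᵇ suc n then toℕ x ≡ᵇ 0 else false)

-- membership in L_{a+1} ∪ L_{a+2} ∪ … ∪ L_{n+1}
inLplus : (n a : ℕ) → Zmod n → Bool
inLplus n a x = any (λ k → inL n (a + suc k) x) (upTo (n ∸ a + 1))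

Subset : ℕ → Set
Subset n = Zmod n → Bool

inS : (n : ℕ) → Subset n → ℕ → Zmod n → Bool
inS n S i x = S x ∧ inL n i x

inSplus : (n : ℕ) → Subset n → ℕ → Zmod n → Bool
inSplus n S a x = S x ∧ inLplus n a x

cardL : (n i : ℕ) → ℕ
cardL n i = count (inL n i) (allFin (2 ^ n))

cardS : (n : ℕ) → Subset n → ℕ → ℕ
cardS n S i = count (inS n S i) (allFin (2 ^ n))

cardSplus : (n : ℕ) → Subset n → ℕ → ℕ
cardSplus n S a = count (inSplus n S a) (allFin (2 ^ n))

triples : (n : ℕ) → List (Zmod n × Zmod n × Zmod n)
triples n =
  concatMap (λ x → concatMap (λ y → map (λ z → (x , y , z)) (allFin (2 ^ n)))
                             (allFin (2 ^ n)))
            (allFin (2 ^ n))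

inC : (n : ℕ) → Subset n → ℕ → Zmod n × Zmod n × Zmod n → Bool
inC n S a (x , y , z) =
  S x ∧ S y ∧ S z ∧ (addMod n x y ≡ᵇ toℕ z)
    ∧ inS n S a x ∧ inS n S a y ∧ inSplus n S a z

cardC : (n : ℕ) → Subset n → ℕ → ℕ
cardC n S a = count (inC n S a) (triples n)

module Submission where

open import Defs
open import Data.Nat using (ℕ; _≤_; suc; s≤s; z≤n)

-- Write a = j + 1 ≤ n.  Reduction modulo 2^a is an additive map π : Z_{2^n} → Z_{2^a},
-- and the levels are two of its fibres: L_a = π⁻¹(2^j) and L_{a+} = π⁻¹(0).  Hence
-- L_a + L_a ⊆ L_{a+} and L_{a+} - L_a ⊆ L_a, and translation by 2^j exchanges the two
-- levels, so |L_{a+}| = |L_a|.  Now |C| is the number of pairs (x, y) ∈ S_a × S_a with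
-- x + y ∈ S_{a+}, and inclusion–exclusion inside one level bounds it twice:
--   for fixed x ∈ S_a, {y ∈ S_a} and {y : x + y ∈ S_{a+}} lie in {y : x + y ∈ L_{a+}},
--   for fixed w ∈ S_{a+}, {x ∈ S_a} and {x : w - x ∈ S_a} lie in {x : w - x ∈ L_a},
-- giving |C| ≥ |S_a|(|S_a| + |S_{a+}| - |L_a|) and |C| ≥ |S_{a+}|(2|S_a| - |L_a|).

module Counting where
  open import Data.Bool using (Bool; true; false; _∧_)
  open import Data.Nat using (zero; _+_; _*_; _<_; _≡ᵇ_)
  open import Data.Nat.Properties
    using (+-mono-≤; ≤-antisym; ≤-trans; ≤-refl; ≤-reflexive; *-identityˡ; +-identityʳ; *-assoc; *-comm;
           +-0-commutativeMonoid; +-*-semiring; module ≤-Reasoning)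
  open import Data.Fin using (Fin; zero; suc; toℕ; fromℕ<)
  open import Data.Fin.Permutation using (permutation)
  open import Data.List using (List; []; _∷_; _++_; map; concatMap; tabulate)
  open import Function using (_∘_)
  open import Relation.Binary.PropositionalEquality
  open import Algebra.Properties.CommutativeMonoid.Sum +-0-commutativeMonoid
    using (sum; sum-cong-≗; sum-replicate-zero; ∑-distrib-+; ∑-comm; ∑-permute)
  open import Algebra.Properties.Semiring.Sum +-*-semiring using (*-distribˡ-sum; *-distribʳ-sum)

  ι : Bool → ℕ
  ι true  = 1
  ι false = 0

  ι-∧ : ∀ b c → ι (b ∧ c) ≡ ι b * ι c
  ι-∧ true  c = sym (*-identityˡ (ι c))
  ι-∧ false c = refl

  ι-mono : ∀ {b c} → (b ≡ true → c ≡ true) → ι b ≤ ι c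
  ι-mono {false} b⇒c = z≤n
  ι-mono {true}  b⇒c rewrite b⇒c refl = ≤-refl

  ι-union : ∀ {p q r} → (p ≡ true → r ≡ true) → (q ≡ true → r ≡ true) →
    ι p + ι q ≤ ι p * ι q + ι r
  ι-union {true}  {true}  p⇒r q⇒r rewrite p⇒r refl = ≤-refl
  ι-union {true}  {false} p⇒r q⇒r rewrite p⇒r refl = ≤-refl
  ι-union {false} {true}  p⇒r q⇒r rewrite q⇒r refl = ≤-refl
  ι-union {false} {false} p⇒r q⇒r = z≤n

  sum-mono : ∀ {m} {f g : Fin m → ℕ} → (∀ i → f i ≤ g i) → sum f ≤ sum g
  sum-mono {zero}  f≤g = z≤n
  sum-mono {suc m} f≤g = +-mono-≤ (f≤g zero) (sum-mono (f≤g ∘ suc))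

  sum-reindex : ∀ {m} (f : Fin m → ℕ) (σ τ : Fin m → Fin m) →
    (∀ y → σ (τ y) ≡ y) → (∀ x → τ (σ x) ≡ x) → sum (f ∘ σ) ≡ sum f
  sum-reindex f σ τ στ τσ = sym (∑-permute f (permutation σ τ στ τσ))

  size : ∀ {m} → (Fin m → Bool) → ℕ
  size P = sum (ι ∘ P)

  sum-weighted : ∀ {m} (W : Fin m → Bool) (g : Fin m → ℕ) (b c : ℕ) →
    (∀ x → W x ≡ true → b ≤ g x + c) →
    size W * b ≤ sum (λ x → ι (W x) * g x) + size W * c
  sum-weighted W g b c bound = begin
      size W * b                                    ≡⟨ *-distribʳ-sum b (ι ∘ W) ⟩
      sum (λ x → ι (W x) * b)                       ≤⟨ sum-mono weighted ⟩
      sum (λ x → ι (W x) * g x + ι (W x) * c)       ≡⟨ ∑-distrib-+ (λ x → ι (W x) * g x) (λ x → ι (W x) * c) ⟩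
      sum (λ x → ι (W x) * g x) + sum (λ x → ι (W x) * c)
                                                    ≡⟨ cong (sum (λ x → ι (W x) * g x) +_) (*-distribʳ-sum c (ι ∘ W)) ⟨
      sum (λ x → ι (W x) * g x) + size W * c        ∎
    where
    open ≤-Reasoning
    weighted : ∀ x → ι (W x) * b ≤ ι (W x) * g x + ι (W x) * c
    weighted x with W x in Wx
    ... | false = z≤n
    ... | true  = subst₂ _≤_ (sym (*-identityˡ b))
                    (sym (cong₂ _+_ (*-identityˡ (g x)) (*-identityˡ c))) (bound x Wx)

  sum-delta : ∀ {m} k (k<m : k < m) (P : Fin m → Bool) →
    sum (λ z → ι ((k ≡ᵇ toℕ z) ∧ P z)) ≡ ι (P (fromℕ< k<m))
  sum-delta {suc m} zero    (s≤s _)   P =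
    trans (cong (ι (P zero) +_) (sum-replicate-zero m)) (+-identityʳ _)
  sum-delta {suc m} (suc k) (s≤s k<m) P = sum-delta k k<m (P ∘ suc)

  count-++ : ∀ {A : Set} (p : A → Bool) xs ys →
    count p (xs ++ ys) ≡ count p xs + count p ys
  count-++ p []       ys = refl
  count-++ p (x ∷ xs) ys with p x
  ... | true  = cong suc (count-++ p xs ys)
  ... | false = count-++ p xs ys

  count-map : ∀ {A B : Set} (p : B → Bool) (f : A → B) xs →
    count p (map f xs) ≡ count (p ∘ f) xs
  count-map p f []       = refl
  count-map p f (x ∷ xs) with p (f x)
  ... | true  = cong suc (count-map p f xs)
  ... | false = count-map p f xs

  count-tabulate : ∀ {A : Set} {m} (p : A → Bool) (g : Fin m → A) →
    count p (tabulate g) ≡ sum (λ i → ι (p (g i)))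
  count-tabulate {m = zero}  p g = refl
  count-tabulate {m = suc m} p g with p (g zero)
  ... | true  = cong suc (count-tabulate p (g ∘ suc))
  ... | false = count-tabulate p (g ∘ suc)

  count-concatMap : ∀ {A B : Set} {m} (p : B → Bool) (f : A → List B) (g : Fin m → A) →
    count p (concatMap f (tabulate g)) ≡ sum (λ i → count p (f (g i)))
  count-concatMap {m = zero}  p f g = refl
  count-concatMap {m = suc m} p f g =
    trans (count-++ p (f (g zero)) _) (cong (count p (f (g zero)) +_) (count-concatMap p f (g ∘ suc)))

  module TranslationCounting
    {m : ℕ} (_⊕_ _⊖_ : Fin m → Fin m → Fin m)
    (⊕-comm : ∀ x y → x ⊕ y ≡ y ⊕ x)
    (⊕-⊖ : ∀ x w → x ⊕ (w ⊖ x) ≡ w)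
    (⊖-⊕ : ∀ x y → (x ⊕ y) ⊖ x ≡ y)
    where

    ⊖-involutive : ∀ w x → w ⊖ (w ⊖ x) ≡ x
    ⊖-involutive w x = begin
      w ⊖ (w ⊖ x)                ≡⟨ cong (_⊖ (w ⊖ x)) (⊕-⊖ x w) ⟨
      (x ⊕ (w ⊖ x)) ⊖ (w ⊖ x)    ≡⟨ cong (_⊖ (w ⊖ x)) (⊕-comm x (w ⊖ x)) ⟩
      ((w ⊖ x) ⊕ x) ⊖ (w ⊖ x)    ≡⟨ ⊖-⊕ (w ⊖ x) x ⟩
      x                          ∎
      where open ≡-Reasoning

    sum-translate : ∀ (f : Fin m → ℕ) x → sum (λ y → f (x ⊕ y)) ≡ sum f
    sum-translate f x = sum-reindex f (x ⊕_) (_⊖ x) (⊕-⊖ x) (⊖-⊕ x)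

    sum-reflect : ∀ (f : Fin m → ℕ) w → sum (λ x → f (w ⊖ x)) ≡ sum f
    sum-reflect f w = sum-reindex f (w ⊖_) (w ⊖_) (⊖-involutive w) (⊖-involutive w)

    size-translate : ∀ (P Q : Fin m → Bool) t →
      (∀ x → P x ≡ true → Q (t ⊕ x) ≡ true) → (∀ x → Q x ≡ true → P (t ⊕ x) ≡ true) →
      size P ≡ size Q
    size-translate P Q t P⇒Q Q⇒P = ≤-antisym (embed P Q P⇒Q) (embed Q P Q⇒P)
      where
      embed : ∀ P Q → (∀ x → P x ≡ true → Q (t ⊕ x) ≡ true) → size P ≤ size Q
      embed P Q P⇒Q = ≤-trans (sum-mono (λ x → ι-mono (P⇒Q x)))
                              (≤-reflexive (sum-translate (ι ∘ Q) t))

    pairCount : (A B : Fin m → Bool) → ℕ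
    pairCount A B = sum (λ x → sum (λ y → ι (A x) * (ι (A y) * ι (B (x ⊕ y)))))

    -- First bound: if A ⊕ A ⊆ U and B ⊆ U then, for each x ∈ A, the sets
    -- {y ∈ A} and {y : x ⊕ y ∈ B} both lie in {y : x ⊕ y ∈ U}, so they meet in
    -- at least |A| + |B| - |U| points.
    pairCount-bound₁ : ∀ (A B U : Fin m → Bool) →
      (∀ x y → A x ≡ true → A y ≡ true → U (x ⊕ y) ≡ true) →
      (∀ z → B z ≡ true → U z ≡ true) →
      size A * (size A + size B) ≤ pairCount A B + size A * size U
    pairCount-bound₁ A B U A⊕A⊆U B⊆U =
      subst (λ s → size A * (size A + size B) ≤ s + size A * size U)
        (sum-cong-≗ (λ x → *-distribˡ-sum (ι (A x)) (λ y → ι (A y) * ι (B (x ⊕ y)))))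
        (sum-weighted A fibre (size A + size B) (size U) fibre-bound)
      where
      fibre : Fin m → ℕ
      fibre x = sum (λ y → ι (A y) * ι (B (x ⊕ y)))

      fibre-bound : ∀ x → A x ≡ true → size A + size B ≤ fibre x + size U
      fibre-bound x Ax = begin
        size A + size B
          ≡⟨ cong (size A +_) (sum-translate (ι ∘ B) x) ⟨
        sum (λ y → ι (A y)) + sum (λ y → ι (B (x ⊕ y)))
          ≡⟨ ∑-distrib-+ (λ y → ι (A y)) (λ y → ι (B (x ⊕ y))) ⟨
        sum (λ y → ι (A y) + ι (B (x ⊕ y)))
          ≤⟨ sum-mono (λ y → ι-union (A⊕A⊆U x y Ax) (B⊆U (x ⊕ y))) ⟩
        sum (λ y → ι (A y) * ι (B (x ⊕ y)) + ι (U (x ⊕ y)))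
          ≡⟨ ∑-distrib-+ (λ y → ι (A y) * ι (B (x ⊕ y))) (λ y → ι (U (x ⊕ y))) ⟩
        fibre x + sum (λ y → ι (U (x ⊕ y)))
          ≡⟨ cong (fibre x +_) (sum-translate (ι ∘ U) x) ⟩
        fibre x + size U ∎
        where open ≤-Reasoning

    -- Reindexing by w = x ⊕ y counts the pairs over their sums w ∈ B.
    pairCount-by-sum : ∀ (A B : Fin m → Bool) →
      pairCount A B ≡ sum (λ w → ι (B w) * sum (λ x → ι (A x) * ι (A (w ⊖ x))))
    pairCount-by-sum A B = begin
      pairCount A B
        ≡⟨ sum-cong-≗ (λ x → sum-reindex (pair x) (_⊖ x) (x ⊕_) (⊖-⊕ x) (⊕-⊖ x)) ⟨
      sum (λ x → sum (λ w → pair x (w ⊖ x)))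
        ≡⟨ sum-cong-≗ (λ x → sum-cong-≗ (λ w → reorder x w)) ⟩
      sum (λ x → sum (λ w → ι (B w) * (ι (A x) * ι (A (w ⊖ x)))))
        ≡⟨ ∑-comm (λ x w → ι (B w) * (ι (A x) * ι (A (w ⊖ x)))) ⟩
      sum (λ w → sum (λ x → ι (B w) * (ι (A x) * ι (A (w ⊖ x)))))
        ≡⟨ sum-cong-≗ (λ w → *-distribˡ-sum (ι (B w)) (λ x → ι (A x) * ι (A (w ⊖ x)))) ⟨
      sum (λ w → ι (B w) * sum (λ x → ι (A x) * ι (A (w ⊖ x)))) ∎
      where
      open ≡-Reasoning
      pair : Fin m → Fin m → ℕ
      pair x y = ι (A x) * (ι (A y) * ι (B (x ⊕ y)))

      reorder : ∀ x w → pair x (w ⊖ x) ≡ ι (B w) * (ι (A x) * ι (A (w ⊖ x)))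
      reorder x w rewrite ⊕-⊖ x w = rotate (ι (A x)) (ι (A (w ⊖ x))) (ι (B w))
        where
        rotate : ∀ a b c → a * (b * c) ≡ c * (a * b)
        rotate a b c = trans (sym (*-assoc a b c)) (*-comm (a * b) c)

    -- Second bound: if B ⊆ U and U ⊖ L ⊆ L, then for each w ∈ B the sets {x ∈ A}
    -- and {x : w ⊖ x ∈ A} both lie in {x : w ⊖ x ∈ L}, so they meet in at least
    -- 2|A| - |L| points.
    pairCount-bound₂ : ∀ (A B L U : Fin m → Bool) →
      (∀ x → A x ≡ true → L x ≡ true) →
      (∀ z → B z ≡ true → U z ≡ true) →
      (∀ x w → L x ≡ true → U w ≡ true → L (w ⊖ x) ≡ true) →
      size B * (size A + size A) ≤ pairCount A B + size B * size L
    pairCount-bound₂ A B L U A⊆L B⊆U U⊖L⊆L =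
      subst (λ s → size B * (size A + size A) ≤ s + size B * size L)
        (sym (pairCount-by-sum A B))
        (sum-weighted B fibre (size A + size A) (size L) fibre-bound)
      where
      fibre : Fin m → ℕ
      fibre w = sum (λ x → ι (A x) * ι (A (w ⊖ x)))

      fibre-bound : ∀ w → B w ≡ true → size A + size A ≤ fibre w + size L
      fibre-bound w Bw = begin
        size A + size A
          ≡⟨ cong (size A +_) (sum-reflect (ι ∘ A) w) ⟨
        sum (λ x → ι (A x)) + sum (λ x → ι (A (w ⊖ x)))
          ≡⟨ ∑-distrib-+ (λ x → ι (A x)) (λ x → ι (A (w ⊖ x))) ⟨
        sum (λ x → ι (A x) + ι (A (w ⊖ x)))
          ≤⟨ sum-mono (λ x → ι-union (λ Ax → U⊖L⊆L x w (A⊆L x Ax) (B⊆U w Bw)) (A⊆L (w ⊖ x))) ⟩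
        sum (λ x → ι (A x) * ι (A (w ⊖ x)) + ι (L (w ⊖ x)))
          ≡⟨ ∑-distrib-+ (λ x → ι (A x) * ι (A (w ⊖ x))) (λ x → ι (L (w ⊖ x))) ⟩
        fibre w + sum (λ x → ι (L (w ⊖ x)))
          ≡⟨ cong (fibre w +_) (sum-reflect (ι ∘ L) w) ⟩
        fibre w + size L ∎
        where open ≤-Reasoning


module ModularArithmetic where
  open import Data.Nat using (_+_; _*_; _∸_; _^_; _%_; _/_; _<_; NonZero)
  open import Data.Nat.Properties
  open import Data.Nat.DivMod
    using (m%n<n; m<n⇒m%n≡m; %-distribˡ-+; [m+n]%n≡m%n; m∣n⇒o%n%m≡o%m; m≡m%n+[m/n]*n; m<n*o⇒m/o<n)
  open import Data.Nat.Divisibility using (_∣_; divides)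
  open import Data.Fin using (Fin; toℕ; fromℕ<)
  open import Data.Fin.Properties using (toℕ-fromℕ<; toℕ-injective; toℕ<n)
  open import Data.Sum using (_⊎_; inj₁; inj₂)
  open import Function using (_⇔_; mk⇔)
  open import Relation.Binary.PropositionalEquality

  module Modular (N : ℕ) .{{_ : NonZero N}} where

    reduce : ℕ → Fin N
    reduce k = fromℕ< (m%n<n k N)

    toℕ-reduce : ∀ k → toℕ (reduce k) ≡ k % N
    toℕ-reduce k = toℕ-fromℕ< (m%n<n k N)

    reduce-toℕ : ∀ x → reduce (toℕ x) ≡ x
    reduce-toℕ x = toℕ-injective (trans (toℕ-reduce (toℕ x)) (m<n⇒m%n≡m (toℕ<n x)))

    reduce-cong : ∀ {k l} → k % N ≡ l % N → reduce k ≡ reduce l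
    reduce-cong {k} {l} k≡l = toℕ-injective (trans (toℕ-reduce k) (trans k≡l (sym (toℕ-reduce l))))

    _⊕_ : Fin N → Fin N → Fin N
    x ⊕ y = reduce (toℕ x + toℕ y)

    _⊖_ : Fin N → Fin N → Fin N
    w ⊖ x = reduce (toℕ w + (N ∸ toℕ x))

    reduce-+ : ∀ k l → reduce k ⊕ reduce l ≡ reduce (k + l)
    reduce-+ k l = reduce-cong (begin
      (toℕ (reduce k) + toℕ (reduce l)) % N  ≡⟨ cong₂ (λ u v → (u + v) % N) (toℕ-reduce k) (toℕ-reduce l) ⟩
      (k % N + l % N) % N                    ≡⟨ %-distribˡ-+ k l N ⟨
      (k + l) % N                            ∎)
      where open ≡-Reasoning

    ⊕-comm : ∀ x y → x ⊕ y ≡ y ⊕ x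
    ⊕-comm x y = cong reduce (+-comm (toℕ x) (toℕ y))

    ⊕-identityʳ : ∀ x → x ⊕ reduce 0 ≡ x
    ⊕-identityʳ x = begin
      x ⊕ reduce 0                 ≡⟨ cong (_⊕ reduce 0) (reduce-toℕ x) ⟨
      reduce (toℕ x) ⊕ reduce 0    ≡⟨ reduce-+ (toℕ x) 0 ⟩
      reduce (toℕ x + 0)           ≡⟨ cong reduce (+-identityʳ (toℕ x)) ⟩
      reduce (toℕ x)               ≡⟨ reduce-toℕ x ⟩
      x                            ∎
      where open ≡-Reasoning

    -- Adding x and then N - x adds N, which is invisible modulo N.
    reduce-complement : ∀ x k → reduce (toℕ x + (k + (N ∸ toℕ x))) ≡ reduce k
    reduce-complement x k = reduce-cong (begin
      (toℕ x + (k + (N ∸ toℕ x))) % N  ≡⟨ cong (_% N) (+-assoc (toℕ x) k _) ⟨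
      (toℕ x + k + (N ∸ toℕ x)) % N    ≡⟨ cong (λ u → (u + (N ∸ toℕ x)) % N) (+-comm (toℕ x) k) ⟩
      (k + toℕ x + (N ∸ toℕ x)) % N    ≡⟨ cong (_% N) (+-assoc k (toℕ x) _) ⟩
      (k + (toℕ x + (N ∸ toℕ x))) % N  ≡⟨ cong (λ u → (k + u) % N) (m+[n∸m]≡n (<⇒≤ (toℕ<n x))) ⟩
      (k + N) % N                      ≡⟨ [m+n]%n≡m%n k N ⟩
      k % N                            ∎)
      where open ≡-Reasoning

    ⊕-⊖ : ∀ x w → x ⊕ (w ⊖ x) ≡ w
    ⊕-⊖ x w = begin
      x ⊕ (w ⊖ x)                                    ≡⟨ cong (_⊕ (w ⊖ x)) (reduce-toℕ x) ⟨
      reduce (toℕ x) ⊕ reduce (toℕ w + (N ∸ toℕ x))  ≡⟨ reduce-+ (toℕ x) _ ⟩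
      reduce (toℕ x + (toℕ w + (N ∸ toℕ x)))         ≡⟨ reduce-complement x (toℕ w) ⟩
      reduce (toℕ w)                                 ≡⟨ reduce-toℕ w ⟩
      w                                              ∎
      where open ≡-Reasoning

    ⊖-⊕ : ∀ x y → (x ⊕ y) ⊖ x ≡ y
    ⊖-⊕ x y = begin
      (x ⊕ y) ⊖ x                                  ≡⟨ reduce-+ (toℕ (x ⊕ y)) (N ∸ toℕ x) ⟨
      reduce (toℕ (x ⊕ y)) ⊕ reduce (N ∸ toℕ x)    ≡⟨ cong (_⊕ reduce (N ∸ toℕ x)) (reduce-toℕ (x ⊕ y)) ⟩
      (x ⊕ y) ⊕ reduce (N ∸ toℕ x)                 ≡⟨ reduce-+ (toℕ x + toℕ y) (N ∸ toℕ x) ⟩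
      reduce (toℕ x + toℕ y + (N ∸ toℕ x))         ≡⟨ cong reduce (+-assoc (toℕ x) (toℕ y) _) ⟩
      reduce (toℕ x + (toℕ y + (N ∸ toℕ x)))       ≡⟨ reduce-complement x (toℕ y) ⟩
      reduce (toℕ y)                               ≡⟨ reduce-toℕ y ⟩
      y                                            ∎
      where open ≡-Reasoning

    reduce≡reduce⇔ : ∀ k l → reduce k ≡ reduce l ⇔ k % N ≡ l % N
    reduce≡reduce⇔ k l = mk⇔
      (λ eq → trans (sym (toℕ-reduce k)) (trans (cong toℕ eq) (toℕ-reduce l)))
      reduce-cong

    ⊕-cancelˡ : ∀ x y z → x ⊕ y ≡ x ⊕ z → y ≡ z
    ⊕-cancelˡ x y z x⊕y≡x⊕z = trans (sym (⊖-⊕ x y)) (trans (cong (_⊖ x) x⊕y≡x⊕z) (⊖-⊕ x z))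

  module Reduction (N M : ℕ) .{{_ : NonZero N}} .{{_ : NonZero M}} (M∣N : M ∣ N) where
    private
      module ZN = Modular N
      module ZM = Modular M

    π : Fin N → Fin M
    π x = ZM.reduce (toℕ x)

    π-reduce : ∀ k → π (ZN.reduce k) ≡ ZM.reduce k
    π-reduce k = ZM.reduce-cong (trans (cong (_% M) (ZN.toℕ-reduce k)) (m∣n⇒o%n%m≡o%m M N k M∣N))

    π-⊕ : ∀ x y → π (x ZN.⊕ y) ≡ π x ZM.⊕ π y
    π-⊕ x y = trans (π-reduce (toℕ x + toℕ y)) (sym (ZM.reduce-+ (toℕ x) (toℕ y)))

  2^-∣ : ∀ {a b} → a ≤ b → 2 ^ a ∣ 2 ^ b
  2^-∣ {a} {b} a≤b = divides (2 ^ (b ∸ a)) (begin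
    2 ^ b                ≡⟨ cong (2 ^_) (m+[n∸m]≡n a≤b) ⟨
    2 ^ (a + (b ∸ a))    ≡⟨ ^-distribˡ-+-* 2 a (b ∸ a) ⟩
    2 ^ a * 2 ^ (b ∸ a)  ≡⟨ *-comm (2 ^ a) _ ⟩
    2 ^ (b ∸ a) * 2 ^ a  ∎)
    where open ≡-Reasoning

  multiple-below-double : ∀ h .{{_ : NonZero h}} r → r < 2 * h → r % h ≡ 0 → r ≡ 0 ⊎ r ≡ h
  multiple-below-double h r r<2h r%h≡0
    with r / h | m<n*o⇒m/o<n {r} {2} {h} r<2h | m≡m%n+[m/n]*n r h
  ... | 0 | _ | r≡r%h+0 = inj₁ (trans r≡r%h+0 (trans (+-identityʳ (r % h)) r%h≡0))
  ... | 1 | _ | r≡r%h+h = inj₂ (trans r≡r%h+h (trans (cong (_+ (h + 0)) r%h≡0) (+-identityʳ h)))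
  ... | suc (suc _) | s≤s (s≤s ()) | _

  residue-split : ∀ k b → modPow2 k b ≡ 0 → modPow2 k (suc b) ≡ 0 ⊎ modPow2 k (suc b) ≡ 2 ^ b
  residue-split k b k%2^b≡0 = multiple-below-double (2 ^ b) (k % 2 ^ suc b) (m%n<n k (2 ^ suc b))
    (trans (m∣n⇒o%n%m≡o%m (2 ^ b) (2 ^ suc b) k (2^-∣ (n≤1+n b))) k%2^b≡0)
    where
    instance
      2^b≢0 : NonZero (2 ^ b)
      2^b≢0 = m^n≢0 2 b
      2^1+b≢0 : NonZero (2 ^ suc b)
      2^1+b≢0 = m^n≢0 2 (suc b)


module Levels where
  open import Data.Bool using (Bool; true; false; T)
  open import Data.Bool.Properties using (T-≡)
  open import Data.Nat using (zero; _+_; _∸_; _^_; _%_; _<_; NonZero; _≡ᵇ_; _≤ᵇ_)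
  open import Data.Nat.Properties
  open import Data.Nat.DivMod using (m*n%n≡0; m<n⇒m%n≡m; m∣n⇒o%n%m≡o%m; n%n≡0)
  open import Data.Nat.Divisibility using (n∣m⇒m%n≡0)
  open import Data.Fin using (Fin; toℕ)
  open import Data.Fin.Properties using (toℕ<n)
  open import Data.Sum using (inj₁; inj₂)
  open import Data.Product using (_,_; ∃-syntax; _×_)
  open import Data.List using (upTo)
  open import Data.List.Membership.Propositional using (_∈_; lose)
  open import Data.List.Membership.Propositional.Properties using (∈-upTo⁺)
  open import Data.List.Relation.Unary.Any using (satisfied)
  open import Data.List.Relation.Unary.Any.Properties using (any⁺; any⁻)
  open import Function using (_∘_; _⇔_; Equivalence; mk⇔)
  open import Relation.Binary.PropositionalEquality
  open import Relation.Nullary using (contradiction)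
  open Equivalence using (to; from)
  open ModularArithmetic

  ≡ᵇ⇔≡ : ∀ m k → (m ≡ᵇ k) ≡ true ⇔ m ≡ k
  ≡ᵇ⇔≡ m k = mk⇔ (≡ᵇ⇒≡ m k ∘ from T-≡) (to T-≡ ∘ ≡⇒≡ᵇ m k)

  inL-below : ∀ {n i} (x : Zmod n) → suc i ≤ n →
    inL n (suc i) x ≡ (modPow2 (toℕ x) (suc i) ≡ᵇ 2 ^ i)
  inL-below {n} {i} x 1+i≤n with suc i ≤ᵇ n | ≤⇒≤ᵇ 1+i≤n
  ... | true | _ = refl

  inL-top : ∀ {n} (x : Zmod n) → inL n (suc n) x ≡ (toℕ x ≡ᵇ 0)
  inL-top {n} x with suc n ≤ᵇ n in 1+n≤ᵇn
  ... | true  = contradiction (≤ᵇ⇒≤ (suc n) n (from T-≡ 1+n≤ᵇn)) (n≮n n)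
  ... | false rewrite from (≡ᵇ⇔≡ n n) refl = refl

  inL⇒multiple : ∀ {n} a i (x : Zmod n) → a < i → inL n i x ≡ true → modPow2 (toℕ x) a ≡ 0
  inL⇒multiple {n} a (suc i) x (s≤s a≤i) x∈Li with suc i ≤ᵇ n
  ... | true = begin
    toℕ x % 2 ^ a                   ≡⟨ m∣n⇒o%n%m≡o%m (2 ^ a) (2 ^ suc i) (toℕ x) (2^-∣ (m≤n⇒m≤1+n a≤i)) ⟨
    toℕ x % 2 ^ suc i % 2 ^ a       ≡⟨ cong (_% 2 ^ a) (to (≡ᵇ⇔≡ _ _) x∈Li) ⟩
    2 ^ i % 2 ^ a                   ≡⟨ n∣m⇒m%n≡0 (2 ^ i) (2 ^ a) (2^-∣ a≤i) ⟩
    0                               ∎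
    where
    open ≡-Reasoning
    instance
      2^a≢0 : NonZero (2 ^ a)
      2^a≢0 = m^n≢0 2 a
      2^1+i≢0 : NonZero (2 ^ suc i)
      2^1+i≢0 = m^n≢0 2 (suc i)
  ... | false with suc i ≡ᵇ suc n
  ...   | true  = trans (cong (λ k → modPow2 k a) (to (≡ᵇ⇔≡ _ _) x∈Li))
                       (m*n%n≡0 0 (2 ^ a) {{m^n≢0 2 a}})
  ...   | false = contradiction x∈Li λ ()

  -- Every multiple x of 2^b, with b ≤ n, lies in some level L_i with b < i ≤ n + 1:
  -- going up from b, the residue of x modulo 2^(b+1) is 0 or 2^b.
  multiple⇒inL : ∀ {n} (x : Zmod n) e b → e + b ≡ n → modPow2 (toℕ x) b ≡ 0 →
    ∃[ i ] (b < i × i ≤ suc n × inL n i x ≡ true)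
  multiple⇒inL {n} x zero .n refl x%2^n≡0 =
    suc n , ≤-refl , ≤-refl ,
    trans (inL-top {n} x) (from (≡ᵇ⇔≡ _ _)
      (trans (sym (m<n⇒m%n≡m {{m^n≢0 2 n}} (toℕ<n x))) x%2^n≡0))
  multiple⇒inL x (suc e) b 1+e+b≡n x%2^b≡0 with residue-split (toℕ x) b x%2^b≡0
  ... | inj₂ x%2^1+b≡2^b =
    suc b , ≤-refl , m≤n⇒m≤1+n 1+b≤n ,
    trans (inL-below x 1+b≤n) (from (≡ᵇ⇔≡ _ _) x%2^1+b≡2^b)
    where
    1+b≤n : suc b ≤ _
    1+b≤n = subst (suc b ≤_) 1+e+b≡n (s≤s (m≤n+m b e))
  ... | inj₁ x%2^1+b≡0 with multiple⇒inL x e (suc b) (trans (+-suc e b) 1+e+b≡n) x%2^1+b≡0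
  ...   | i , 1+b<i , i≤1+n , x∈Li = i , <-trans (n<1+n b) 1+b<i , i≤1+n , x∈Li

  inLplus⇔multiple : ∀ {n a} (x : Zmod n) → a ≤ n → inLplus n a x ≡ true ⇔ modPow2 (toℕ x) a ≡ 0
  inLplus⇔multiple {n} {a} x a≤n = mk⇔ multiple member
    where
    level : ℕ → Bool
    level k = inL n (a + suc k) x

    multiple : inLplus n a x ≡ true → modPow2 (toℕ x) a ≡ 0
    multiple x∈U with satisfied (any⁻ level (upTo (n ∸ a + 1)) (from T-≡ x∈U))
    ... | k , x∈L = inL⇒multiple a (a + suc k) x (m<m+n a (s≤s z≤n)) (to T-≡ x∈L)

    member : modPow2 (toℕ x) a ≡ 0 → inLplus n a x ≡ true
    member x%2^a≡0 with multiple⇒inL x (n ∸ a) a (m∸n+n≡m a≤n) x%2^a≡0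
    ... | i , a<i , i≤1+n , x∈Li = to T-≡ (any⁺ level (lose k∈range x∈Lk))
      where
      k : ℕ
      k = i ∸ suc a
      a+1+k≡i : a + suc k ≡ i
      a+1+k≡i = trans (+-suc a k) (m+[n∸m]≡n a<i)
      k∈range : k ∈ upTo (n ∸ a + 1)
      k∈range = ∈-upTo⁺ (subst (k <_) (+-comm 1 (n ∸ a)) (s≤s (∸-monoˡ-≤ (suc a) i≤1+n)))
      x∈Lk : T (level k)
      x∈Lk = from T-≡ (subst (λ l → inL n l x ≡ true) (sym a+1+k≡i) x∈Li)

  module Fibres {n j : ℕ} (1+j≤n : suc j ≤ n) where
    instance
      2^n≢0 : NonZero (2 ^ n)
      2^n≢0 = m^n≢0 2 n
      2^1+j≢0 : NonZero (2 ^ suc j)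
      2^1+j≢0 = m^n≢0 2 (suc j)

    private module ZM = Modular (2 ^ suc j)

    open Modular (2 ^ n) public
    open Reduction (2 ^ n) (2 ^ suc j) (2^-∣ 1+j≤n) public

    L U : Zmod n → Bool
    L = inL n (suc j)
    U = inLplus n (suc j)

    mid : Fin (2 ^ suc j)
    mid = ZM.reduce (2 ^ j)

    mid⊕mid : mid ZM.⊕ mid ≡ ZM.reduce 0
    mid⊕mid = trans (ZM.reduce-+ (2 ^ j) (2 ^ j)) (ZM.reduce-cong (begin
      (2 ^ j + 2 ^ j) % 2 ^ suc j  ≡⟨ cong (λ u → (2 ^ j + u) % 2 ^ suc j) (+-identityʳ (2 ^ j)) ⟨
      2 ^ suc j % 2 ^ suc j        ≡⟨ n%n≡0 (2 ^ suc j) ⟩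
      0                            ≡⟨ m*n%n≡0 0 (2 ^ suc j) ⟨
      0 % 2 ^ suc j                ∎))
      where open ≡-Reasoning

    2^j%2^1+j≡2^j : 2 ^ j % 2 ^ suc j ≡ 2 ^ j
    2^j%2^1+j≡2^j = m<n⇒m%n≡m (m<m+n (2 ^ j) (subst (0 <_) (sym (+-identityʳ (2 ^ j))) (m^n>0 2 j)))

    L⇔mid : ∀ x → L x ≡ true ⇔ π x ≡ mid
    L⇔mid x = mk⇔
      (λ x∈L → from (ZM.reduce≡reduce⇔ _ _)
        (trans (to (≡ᵇ⇔≡ _ _) (trans (sym (inL-below x 1+j≤n)) x∈L)) (sym 2^j%2^1+j≡2^j)))
      (λ πx≡mid → trans (inL-below x 1+j≤n)
        (from (≡ᵇ⇔≡ _ _) (trans (to (ZM.reduce≡reduce⇔ _ _) πx≡mid) 2^j%2^1+j≡2^j)))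

    U⇔zero : ∀ x → U x ≡ true ⇔ π x ≡ ZM.reduce 0
    U⇔zero x = mk⇔
      (λ x∈U → from (ZM.reduce≡reduce⇔ _ _)
        (trans (to (inLplus⇔multiple x 1+j≤n) x∈U) (sym (m*n%n≡0 0 (2 ^ suc j)))))
      (λ πx≡0 → from (inLplus⇔multiple x 1+j≤n)
        (trans (to (ZM.reduce≡reduce⇔ _ _) πx≡0) (m*n%n≡0 0 (2 ^ suc j))))

    L⊕L⊆U : ∀ x y → L x ≡ true → L y ≡ true → U (x ⊕ y) ≡ true
    L⊕L⊆U x y x∈L y∈L = from (U⇔zero (x ⊕ y)) (begin
      π (x ⊕ y)        ≡⟨ π-⊕ x y ⟩
      π x ZM.⊕ π y     ≡⟨ cong₂ ZM._⊕_ (to (L⇔mid x) x∈L) (to (L⇔mid y) y∈L) ⟩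
      mid ZM.⊕ mid     ≡⟨ mid⊕mid ⟩
      ZM.reduce 0      ∎)
      where open ≡-Reasoning

    U⊖L⊆L : ∀ x w → L x ≡ true → U w ≡ true → L (w ⊖ x) ≡ true
    U⊖L⊆L x w x∈L w∈U = from (L⇔mid (w ⊖ x)) (ZM.⊕-cancelˡ mid (π (w ⊖ x)) mid (begin
      mid ZM.⊕ π (w ⊖ x)   ≡⟨ cong (ZM._⊕ π (w ⊖ x)) (to (L⇔mid x) x∈L) ⟨
      π x ZM.⊕ π (w ⊖ x)   ≡⟨ π-⊕ x (w ⊖ x) ⟨
      π (x ⊕ (w ⊖ x))      ≡⟨ cong π (⊕-⊖ x w) ⟩
      π w                  ≡⟨ to (U⇔zero w) w∈U ⟩
      ZM.reduce 0          ≡⟨ mid⊕mid ⟨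
      mid ZM.⊕ mid         ∎))
      where open ≡-Reasoning

    shift : Zmod n
    shift = reduce (2 ^ j)

    shift∈L : L shift ≡ true
    shift∈L = from (L⇔mid shift) (π-reduce (2 ^ j))

    shift⊕U⊆L : ∀ w → U w ≡ true → L (shift ⊕ w) ≡ true
    shift⊕U⊆L w w∈U = from (L⇔mid (shift ⊕ w)) (begin
      π (shift ⊕ w)          ≡⟨ π-⊕ shift w ⟩
      π shift ZM.⊕ π w       ≡⟨ cong₂ ZM._⊕_ (π-reduce (2 ^ j)) (to (U⇔zero w) w∈U) ⟩
      mid ZM.⊕ ZM.reduce 0   ≡⟨ ZM.⊕-identityʳ mid ⟩
      mid                    ∎)
      where open ≡-Reasoning


module Schur where
  open import Data.Bool using (Bool; true; false; _∧_)
  open import Data.Bool.Properties using (∧-zeroʳ)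
  open import Data.Nat using (_+_; _*_; _^_; _≡ᵇ_)
  open import Data.Nat.Properties using (m^n≢0; +-0-commutativeMonoid)
  open import Data.Nat.DivMod using (m%n<n)
  open import Data.Fin using (toℕ)
  open import Data.List using (List; allFin; map; concatMap)
  open import Data.Product using (_,_; _×_)
  open import Function using (id)
  open import Relation.Binary.PropositionalEquality
  open import Algebra.Properties.CommutativeMonoid.Sum +-0-commutativeMonoid using (sum; sum-cong-≗)
  open Counting
  open Levels

  -- The test for (x, y, z) ∈ C(a,a,a+) is "z = x + y" together with "x, y ∈ S_a and z ∈ S_{a+}".
  ∧-factor : ∀ sx sy sz e lx ly lz →
    (sx ∧ sy ∧ sz ∧ e ∧ (sx ∧ lx) ∧ (sy ∧ ly) ∧ (sz ∧ lz)) ≡ e ∧ ((sx ∧ lx) ∧ (sy ∧ ly) ∧ (sz ∧ lz))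
  ∧-factor false sy    sz    e lx ly lz = sym (∧-zeroʳ e)
  ∧-factor true  false sz    e lx ly lz rewrite ∧-zeroʳ lx = sym (∧-zeroʳ e)
  ∧-factor true  true  false e lx ly lz rewrite ∧-zeroʳ ly | ∧-zeroʳ lx = sym (∧-zeroʳ e)
  ∧-factor true  true  true  e lx ly lz = refl

  module SchurTriples {n j : ℕ} (1+j≤n : suc j ≤ n) (S : Subset n) where
    open Fibres 1+j≤n
    open TranslationCounting _⊕_ _⊖_ ⊕-comm ⊕-⊖ ⊖-⊕

    A B : Zmod n → Bool
    A = inS n S (suc j)
    B = inSplus n S (suc j)

    A⊆L : ∀ x → A x ≡ true → L x ≡ true
    A⊆L x with S x
    ... | true = λ x∈L → x∈L

    B⊆U : ∀ x → B x ≡ true → U x ≡ true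
    B⊆U x with S x
    ... | true = λ x∈U → x∈U

    size-U≡size-L : size U ≡ size L
    size-U≡size-L = sym (size-translate L U shift (λ x → L⊕L⊆U shift x shift∈L) shift⊕U⊆L)

    triples-with : Zmod n → Zmod n → List (Zmod n × Zmod n × Zmod n)
    triples-with x y = map (λ z → (x , y , z)) (allFin (2 ^ n))

    -- For fixed x, y the only candidate third coordinate is z = x + y.
    triples-over : ∀ x y → count (inC n S (suc j)) (triples-with x y) ≡ ι (A x) * (ι (A y) * ι (B (x ⊕ y)))
    triples-over x y = begin
      count (inC n S (suc j)) (triples-with x y)
        ≡⟨ count-map (inC n S (suc j)) (λ z → (x , y , z)) (allFin (2 ^ n)) ⟩
      count (λ z → inC n S (suc j) (x , y , z)) (allFin (2 ^ n))
        ≡⟨ count-tabulate (λ z → inC n S (suc j) (x , y , z)) id ⟩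
      sum (λ z → ι (inC n S (suc j) (x , y , z)))
        ≡⟨ sum-cong-≗ (λ z → cong ι (∧-factor (S x) (S y) (S z) (addMod n x y ≡ᵇ toℕ z) (L x) (L y) (U z))) ⟩
      sum (λ z → ι ((addMod n x y ≡ᵇ toℕ z) ∧ (A x ∧ A y ∧ B z)))
        ≡⟨ sum-delta (addMod n x y) (m%n<n (toℕ x + toℕ y) (2 ^ n) {{m^n≢0 2 n}}) (λ z → A x ∧ A y ∧ B z) ⟩
      ι (A x ∧ A y ∧ B (x ⊕ y))
        ≡⟨ trans (ι-∧ (A x) _) (cong (ι (A x) *_) (ι-∧ (A y) _)) ⟩
      ι (A x) * (ι (A y) * ι (B (x ⊕ y))) ∎
      where open ≡-Reasoning

    cardC≡pairCount : cardC n S (suc j) ≡ pairCount A B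
    cardC≡pairCount =
      trans (count-concatMap (inC n S (suc j)) (λ x → concatMap (triples-with x) (allFin (2 ^ n))) id)
        (sum-cong-≗ λ x → trans (count-concatMap (inC n S (suc j)) (triples-with x) id)
          (sum-cong-≗ λ y → triples-over x y))

    cardS≡size : cardS n S (suc j) ≡ size A
    cardS≡size = count-tabulate A id

    cardSplus≡size : cardSplus n S (suc j) ≡ size B
    cardSplus≡size = count-tabulate B id

    cardL≡size : cardL n (suc j) ≡ size L
    cardL≡size = count-tabulate L id

    -- |C| ≥ |S_a| (|S_a| + |S_{a+}| - |L_a|), with the subtraction moved to the left.
    bound₁ : cardS n S (suc j) * (cardS n S (suc j) + cardSplus n S (suc j))
             ≤ cardC n S (suc j) + cardS n S (suc j) * cardL n (suc j)
    bound₁ rewrite cardS≡size | cardSplus≡size | cardL≡size | cardC≡pairCount =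
      subst (λ l → size A * (size A + size B) ≤ pairCount A B + size A * l) size-U≡size-L
        (pairCount-bound₁ A B U (λ x y x∈A y∈A → L⊕L⊆U x y (A⊆L x x∈A) (A⊆L y y∈A)) B⊆U)

    -- |C| ≥ |S_{a+}| (2 |S_a| - |L_a|), with the subtraction moved to the left.
    bound₂ : cardSplus n S (suc j) * (cardS n S (suc j) + cardS n S (suc j))
             ≤ cardC n S (suc j) + cardSplus n S (suc j) * cardL n (suc j)
    bound₂ rewrite cardS≡size | cardSplus≡size | cardL≡size | cardC≡pairCount =
      pairCount-bound₂ A B L U A⊆L B⊆U U⊖L⊆L


module IntegerForm where
  open import Data.Integer using (+_; _+_; _-_; _*_; _⊔_; _⊖_; +≤+) renaming (_≤_ to _≤ℤ_)
  open import Data.Integer.Properties using ([+m]-[+n]≡m⊖n; ⊖-monoˡ-≤; ≤-⊖; ⊔-lub; pos-+; pos-*; module ≤-Reasoning)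
  open import Data.Integer.Solver using (module +-*-Solver)
  open +-*-Solver
  open import Relation.Binary.PropositionalEquality using (_≡_; refl; sym; trans; cong; cong₂; subst)
  import Data.Nat as N
  import Data.Nat.Properties as NP

  ≤+⇒-≤ : ∀ p q c → p N.≤ c N.+ q → (+ p) - (+ q) ≤ℤ + c
  ≤+⇒-≤ p q c p≤c+q = begin
    (+ p) - (+ q)         ≡⟨ [+m]-[+n]≡m⊖n p q ⟩
    p ⊖ q                 ≤⟨ ⊖-monoˡ-≤ q p≤c+q ⟩
    (c N.+ q) ⊖ q         ≡⟨ ≤-⊖ (NP.m≤n+m q c) ⟩
    + (c N.+ q N.∸ q)     ≡⟨ cong +_ (NP.m+n∸n≡m c q) ⟩
    + c                   ∎
    where open ≤-Reasoning

  first-form : ∀ s t l → (+ s) * ((+ t) - (+ l) + (+ s)) ≡ (+ (s N.* (s N.+ t))) - (+ (s N.* l))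
  first-form s t l = trans
    (solve 3 (λ S T L → S :* (T :- L :+ S) := S :* (S :+ T) :- S :* L) refl (+ s) (+ t) (+ l))
    (sym (cong₂ _-_ (trans (pos-* s (s N.+ t)) (cong ((+ s) *_) (pos-+ s t))) (pos-* s l)))

  second-form : ∀ s t l → (+ t) * ((+ 2) * (+ s) - (+ l)) ≡ (+ (t N.* (s N.+ s))) - (+ (t N.* l))
  second-form s t l = trans
    (solve 3 (λ S T L → T :* (con (+ 2) :* S :- L) := T :* (S :+ S) :- T :* L) refl (+ s) (+ t) (+ l))
    (sym (cong₂ _-_ (trans (pos-* t (s N.+ s)) (cong ((+ t) *_) (pos-+ s s))) (pos-* t l)))

  max-bound : ∀ s t l c →
    s N.* (s N.+ t) N.≤ c N.+ s N.* l → t N.* (s N.+ s) N.≤ c N.+ t N.* l →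
    (((+ s) * ((+ t) - (+ l) + (+ s))) ⊔ ((+ t) * ((+ 2) * (+ s) - (+ l))) ⊔ (+ 0)) ≤ℤ (+ c)
  max-bound s t l c first second = ⊔-lub (⊔-lub
      (subst (_≤ℤ + c) (sym (first-form s t l)) (≤+⇒-≤ _ _ c first))
      (subst (_≤ℤ + c) (sym (second-form s t l)) (≤+⇒-≤ _ _ c second)))
    (+≤+ z≤n)


open import Data.Integer using (ℤ; +_; _+_; _-_; _*_; _⊔_) renaming (_≤_ to _≤ℤ_)

claim4p2 : (n : ℕ) → 1 ≤ n → (S : Subset n) → (a : ℕ) → 1 ≤ a → a ≤ n →
    (((+ cardS n S a) * ((+ cardSplus n S a) - (+ cardL n a) + (+ cardS n S a)))
      ⊔ ((+ cardSplus n S a) * ((+ 2) * (+ cardS n S a) - (+ cardL n a)))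
      ⊔ (+ 0))
    ≤ℤ (+ cardC n S a)
claim4p2 n _ S (suc j) (s≤s z≤n) 1+j≤n =
  IntegerForm.max-bound (cardS n S (suc j)) (cardSplus n S (suc j)) (cardL n (suc j)) (cardC n S (suc j))
    bound₁ bound₂
  where open Schur.SchurTriples 1+j≤n S
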